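{- Let $C$ be an $(X,2)$-neighbour transitive code in $H(m,q)$ with minimum distance $\delta\ge5$ and $\mathbf{0}\in C$. Then $\binom{m}{2}(q-1)^2$ divides $|X_{\mathbf{0}}|$, and hence divides $|X|$. In particular, if $|X_{\mathbf{0}}|=m(m-1)/2$ then $q=2$.
   Context: The Hamming graph $H(m,q)$ has vertices the $m$-tuples over an alphabet $Q$ ($|Q|=q\ge2$, with a distinguished element $0$) indexed by an entry set of size $m$, adjacent iff differing in one entry; $\mathbf{0}=(0,\dots,0)$. For a code $C$, $\delta$ is its minimum distance, $C_i$ the set of vertices at distance exactly $i$ from $C$, $\mathrm{Aut}(C)$ its setwise stabiliser in $\mathrm{Aut}(H(m,q))$. For $X\le\mathrm{Aut}(C)$, $C$ is $(X,s)$-neighbour transitive if $X$ is transitive on each of $C,C_1,\dots,C_s$. $X_{\mathbf{0}}$ is the stabiliser of $\mathbf{0}$ in $X$. -}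

module Defs where

open import Data.Nat using (ℕ; zero; suc; _+_; _≤_; s≤s; z≤n)
open import Data.Fin using (Fin) renaming (zero to fzero)
import Data.Fin as F
open import Data.Vec using (Vec; []; _∷_)
open import Data.Vec.Properties using (≡-dec)
open import Data.List using (List; length; filter)
open import Data.List.Relation.Unary.Any using (Any)
open import Data.List.Relation.Unary.All using (All)
open import Data.List.Relation.Unary.AllPairs using (AllPairs)
open import Data.Product using (Σ; _×_; _,_; ∃)
open import Function.Bundles using (_⇔_)
open import Relation.Nullary using (¬_; yes; no)
open import Relation.Binary.PropositionalEquality using (_≡_; _≢_)

Vertex : ℕ → ℕ → Set
Vertex m q = Vec (Fin q) m

dist : ∀ {m q} → Vertex m q → Vertex m q → ℕ
dist [] [] = 0
dist (x ∷ xs) (y ∷ ys) with x F.≟ y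
... | yes _ = dist xs ys
... | no  _ = suc (dist xs ys)

Adjacent : ∀ {m q} → Vertex m q → Vertex m q → Set
Adjacent u v = dist u v ≡ 1

0Q : ∀ {q} → 2 ≤ q → Fin q
0Q (s≤s _) = fzero

𝟎 : ∀ {m q} → 2 ≤ q → Vertex m q
𝟎 {zero}  q2 = []
𝟎 {suc m} q2 = 0Q q2 ∷ 𝟎 q2

_≟V_ : ∀ {m q} (u v : Vertex m q) → Relation.Nullary.Dec (u ≡ v)
_≟V_ = ≡-dec F._≟_

record Aut (m q : ℕ) : Set where
  field
    fun    : Vertex m q → Vertex m q
    inv    : Vertex m q → Vertex m q
    inv-l  : ∀ v → inv (fun v) ≡ v
    inv-r  : ∀ v → fun (inv v) ≡ v
    adj    : ∀ u v → Adjacent u v ⇔ Adjacent (fun u) (fun v)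
open Aut public

_≈A_ : ∀ {m q} → Aut m q → Aut m q → Set
g ≈A h = ∀ v → fun g v ≡ fun h v

-- A finite subgroup X of Aut(H(m,q)), given by the duplicate-free list of its
-- elements: contains the identity, closed under composition and inverses.
record IsSubgroup {m q} (X : List (Aut m q)) : Set where
  field
    distinct : AllPairs (λ g h → ¬ (g ≈A h)) X
    has-id   : Any (λ k → ∀ v → fun k v ≡ v) X
    comp     : All (λ g → All (λ h → Any (λ k → ∀ v → fun k v ≡ fun g (fun h v)) X) X) X
    inverse  : All (λ g → Any (λ k → ∀ v → fun k v ≡ inv g v) X) X

order : ∀ {m q} → List (Aut m q) → ℕ
order = length

stabOrder : ∀ {m q} → 2 ≤ q → List (Aut m q) → ℕ
stabOrder q2 X = length (filter (λ g → fun g (𝟎 q2) ≟V 𝟎 q2) X)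

Code : ℕ → ℕ → Set₁
Code m q = Vertex m q → Set

-- Minimum distance at least d (for a code with at least two codewords).
MinDistAtLeast : ∀ {m q} → Code m q → ℕ → Set
MinDistAtLeast C d = ∀ c c' → C c → C c' → c ≢ c' → d ≤ dist c c'

DistSet : ∀ {m q} → Code m q → ℕ → Vertex m q → Set
DistSet C i v = (∃ λ c → C c × dist v c ≡ i) × (∀ c → C c → i ≤ dist v c)

StabilisesCode : ∀ {m q} → List (Aut m q) → Code m q → Set
StabilisesCode X C = All (λ g → ∀ v → C v ⇔ C (fun g v)) X

TransitiveOn : ∀ {m q} → List (Aut m q) → (Vertex m q → Set) → Set
TransitiveOn X S = ∀ u v → S u → S v → Any (λ g → fun g u ≡ v) X

NeighbourTransitive : ∀ {m q} → List (Aut m q) → Code m q → ℕ → Set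
NeighbourTransitive X C s =
  StabilisesCode X C × (∀ i → i ≤ s → TransitiveOn X (DistSet C i))

module Submission where

-- Let C be (X,2)-neighbour transitive in H(m,q) with 𝟎 ∈ C and minimum
-- distance at least 5.  The proof is orbit–stabiliser applied twice.
--
--  * X_𝟎 is transitive on the sphere S₂(𝟎) of radius 2 around 𝟎: every vertex
--    of S₂(𝟎) lies in C₂, so X moves any one of them to any other, and an
--    element doing so must fix 𝟎, because the radius-2 balls around distinct
--    codewords are disjoint.  Hence |X_𝟎| = |S₂(𝟎)| · |(X_𝟎)_v| for v ∈ S₂(𝟎).
--  * |S_j(𝟎)| = (m choose j)·(q-1)^j, by counting over an explicit
--    enumeration of the vertices.
--  * Orbit–stabiliser for X acting on 𝟎 gives |X_𝟎| ∣ |X|.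

open import Defs
open import Data.Nat using (ℕ; _≤_; _*_; _∸_; _^_; _/_)
open import Data.Nat.Divisibility using (_∣_)
open import Data.Nat.Combinatorics using (_C_)
open import Data.List using (List)
open import Data.Product using (_×_; ∃)
open import Relation.Binary.PropositionalEquality using (_≡_; _≢_)

open import Data.Bool using (true; false)
open import Data.Nat using (zero; suc; _+_; _<_; z≤n; s≤s; >-nonZero)
open import Data.Nat.Properties
open import Data.Nat.Divisibility using (divides; ∣-trans)
open import Data.Nat.DivMod using (m≥n⇒m/n>0)
open import Data.Nat.Combinatorics using (nCk≡nPk/k!; nCk+nC[k+1]≡[n+1]C[k+1])
open import Data.Nat.ListAction using (sum)
open import Data.Fin using (Fin) renaming (zero to fzero; suc to fsuc)
import Data.Fin as F
import Data.Fin.Properties as Finₚ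
open import Data.Vec using ([]; _∷_)
open import Data.Vec.Properties using (∷-injective)
open import Data.List using ([]; _∷_; [_]; _++_; map; concatMap; length; filter)
open import Data.List.Properties
  using (length-++; length-map; map-∘; map-cong; filter-++; filter-≐; filter-none;
         filter-accept; filter-reject; length-removeAt′)
open import Data.List.Relation.Unary.Any using (Any; here; there; _─_; index; any?)
open import Data.List.Relation.Unary.All as All using (All; []; _∷_)
open import Data.List.Relation.Unary.AllPairs using (AllPairs; []; _∷_)
import Data.List.Relation.Unary.AllPairs.Properties as AllPairs
open import Data.List.Membership.Propositional using (_∈_; find; lose)
open import Data.List.Membership.Propositional.Properties using (∈-filter⁺; ∈-filter⁻)
open import Data.Product using (_,_; proj₁; proj₂)
open import Data.Sum using (_⊎_; inj₁; inj₂)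
open import Data.Empty using (⊥-elim)
open import Function using (_∘_)
open import Function.Bundles using (Equivalence; _⇔_)
import Function.Properties.Equivalence as ⇔
open import Relation.Nullary using (¬_; Dec; yes; no; does)
open import Relation.Unary using (Pred; Decidable)
open import Relation.Binary.PropositionalEquality using (refl; sym; trans; cong; cong₂; subst; subst₂; module ≡-Reasoning)
open import Algebra.Properties.CommutativeSemigroup +-commutativeSemigroup using (interchange)
open import Algebra.Properties.CommutativeSemigroup *-commutativeSemigroup using () renaming (x∙yz≈y∙xz to *-leftSwap)

letterDist : ∀ {q} → Fin q → Fin q → ℕ
letterDist x y with x F.≟ y
... | yes _ = 0
... | no  _ = 1

dist-∷ : ∀ {m q} (x y : Fin q) (u v : Vertex m q) →
  dist (x ∷ u) (y ∷ v) ≡ letterDist x y + dist u v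
dist-∷ x y u v with x F.≟ y
... | yes _ = refl
... | no  _ = refl

letterDist-refl : ∀ {q} (x : Fin q) → letterDist x x ≡ 0
letterDist-refl x with x F.≟ x
... | yes _   = refl
... | no  x≢x = ⊥-elim (x≢x refl)

letterDist-≢ : ∀ {q} {x y : Fin q} → x ≢ y → letterDist x y ≡ 1
letterDist-≢ {x = x} {y} x≢y with x F.≟ y
... | yes x≡y = ⊥-elim (x≢y x≡y)
... | no  _   = refl

letterDist-sym : ∀ {q} (x y : Fin q) → letterDist x y ≡ letterDist y x
letterDist-sym x y with x F.≟ y
... | yes refl = sym (letterDist-refl x)
... | no  x≢y  = sym (letterDist-≢ (x≢y ∘ sym))

letterDist≤1 : ∀ {q} (x y : Fin q) → letterDist x y ≤ 1
letterDist≤1 x y with x F.≟ y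
... | yes _ = z≤n
... | no  _ = s≤s z≤n

letterDist-triangle : ∀ {q} (x y z : Fin q) → letterDist x z ≤ letterDist x y + letterDist y z
letterDist-triangle x y z with x F.≟ z
... | yes _ = z≤n
... | no x≢z with x F.≟ y
...   | no  _    = s≤s z≤n
...   | yes refl = ≤-reflexive (sym (letterDist-≢ x≢z))

dist-refl : ∀ {m q} (u : Vertex m q) → dist u u ≡ 0
dist-refl []      = refl
dist-refl (x ∷ u) = trans (dist-∷ x x u u) (cong₂ _+_ (letterDist-refl x) (dist-refl u))

dist-sym : ∀ {m q} (u v : Vertex m q) → dist u v ≡ dist v u
dist-sym []      []      = refl
dist-sym (x ∷ u) (y ∷ v) = begin
  dist (x ∷ u) (y ∷ v)       ≡⟨ dist-∷ x y u v ⟩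
  letterDist x y + dist u v  ≡⟨ cong₂ _+_ (letterDist-sym x y) (dist-sym u v) ⟩
  letterDist y x + dist v u  ≡⟨ dist-∷ y x v u ⟨
  dist (y ∷ v) (x ∷ u)       ∎
  where open ≡-Reasoning

dist≤length : ∀ {m q} (u v : Vertex m q) → dist u v ≤ m
dist≤length []      []      = z≤n
dist≤length (x ∷ u) (y ∷ v) =
  ≤-trans (≤-reflexive (dist-∷ x y u v)) (+-mono-≤ (letterDist≤1 x y) (dist≤length u v))

dist-zero : ∀ {m q} (u v : Vertex m q) → dist u v ≡ 0 → u ≡ v
dist-zero []      []      _ = refl
dist-zero (x ∷ u) (y ∷ v) d with x F.≟ y
... | yes x≡y = cong₂ _∷_ x≡y (dist-zero u v d)
... | no  _ with () ← d

dist-triangle : ∀ {m q} (u v w : Vertex m q) → dist u w ≤ dist u v + dist v w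
dist-triangle []      []      []      = z≤n
dist-triangle (x ∷ u) (y ∷ v) (z ∷ w) = begin
  dist (x ∷ u) (z ∷ w)
    ≡⟨ dist-∷ x z u w ⟩
  letterDist x z + dist u w
    ≤⟨ +-mono-≤ (letterDist-triangle x y z) (dist-triangle u v w) ⟩
  (letterDist x y + letterDist y z) + (dist u v + dist v w)
    ≡⟨ interchange (letterDist x y) (letterDist y z) (dist u v) (dist v w) ⟩
  (letterDist x y + dist u v) + (letterDist y z + dist v w)
    ≡⟨ sym (cong₂ _+_ (dist-∷ x y u v) (dist-∷ y z v w)) ⟩
  dist (x ∷ u) (y ∷ v) + dist (y ∷ v) (z ∷ w) ∎
  where open ≤-Reasoning

dist-step : ∀ {m q} (u w : Vertex m q) {n} → dist u w ≡ suc n →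
  ∃ λ z → dist u z ≡ 1 × dist z w ≡ n
dist-step [] [] ()
dist-step (x ∷ u) (y ∷ w) d with x F.≟ y
... | yes refl with dist-step u w d
...   | z , uz , zw = x ∷ z , keep-head u z uz , keep-head z w zw
  where
    keep-head : ∀ {k} (a b : Vertex _ _) → dist a b ≡ k → dist (x ∷ a) (x ∷ b) ≡ k
    keep-head a b ab = trans (dist-∷ x x a b) (cong₂ _+_ (letterDist-refl x) ab)
dist-step (x ∷ u) (y ∷ w) refl | no x≢y =
  y ∷ u ,
  trans (dist-∷ x y u u) (cong₂ _+_ (letterDist-≢ x≢y) (dist-refl u)) ,
  trans (dist-∷ y y u w) (cong (_+ dist u w) (letterDist-refl y))

aut-injective : ∀ {m q} (g : Aut m q) {u v} → fun g u ≡ fun g v → u ≡ v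
aut-injective g {u} {v} gu≡gv = begin
  u               ≡⟨ inv-l g u ⟨
  inv g (fun g u) ≡⟨ cong (inv g) gu≡gv ⟩
  inv g (fun g v) ≡⟨ inv-l g v ⟩
  v               ∎
  where open ≡-Reasoning

aut⁻¹ : ∀ {m q} → Aut m q → Aut m q
aut⁻¹ g = record
  { fun   = inv g
  ; inv   = fun g
  ; inv-l = inv-r g
  ; inv-r = inv-l g
  ; adj   = λ u v → ⇔.sym (subst₂ (λ u′ v′ → Adjacent (inv g u) (inv g v) ⇔ Adjacent u′ v′)
                                  (inv-r g u) (inv-r g v) (adj g (inv g u) (inv g v)))
  }

-- Adjacency-preserving maps do not increase distance: map a shortest path.
aut-nonexpanding : ∀ {m q} (g : Aut m q) n (u v : Vertex m q) →
  dist u v ≡ n → dist (fun g u) (fun g v) ≤ n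
aut-nonexpanding g zero u v d rewrite dist-zero u v d = ≤-reflexive (dist-refl (fun g v))
aut-nonexpanding g (suc n) u v d with dist-step u v d
... | z , uz , zv = begin
  dist (fun g u) (fun g v)                            ≤⟨ dist-triangle (fun g u) (fun g z) (fun g v) ⟩
  dist (fun g u) (fun g z) + dist (fun g z) (fun g v) ≤⟨ +-mono-≤ (≤-reflexive (Equivalence.to (adj g u z) uz))
                                                                  (aut-nonexpanding g n z v zv) ⟩
  suc n                                               ∎
  where open ≤-Reasoning

-- Automorphisms preserve Hamming distance: neither g nor its inverse
-- increases it.
aut-isometry : ∀ {m q} (g : Aut m q) (u v : Vertex m q) → dist (fun g u) (fun g v) ≡ dist u v
aut-isometry g u v = ≤-antisym (aut-nonexpanding g _ u v refl) expanding
  where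
    expanding : dist u v ≤ dist (fun g u) (fun g v)
    expanding = subst₂ (λ a b → dist a b ≤ dist (fun g u) (fun g v)) (inv-l g u) (inv-l g v)
                  (aut-nonexpanding (aut⁻¹ g) _ (fun g u) (fun g v) refl)

count : ∀ {a p} {A : Set a} {P : Pred A p} → Decidable P → List A → ℕ
count P? xs = length (filter P? xs)

module _ {a p} {A : Set a} {P : Pred A p} (P? : Decidable P) where

  count-++ : ∀ xs ys → count P? (xs ++ ys) ≡ count P? xs + count P? ys
  count-++ xs ys = trans (cong length (filter-++ P? xs ys)) (length-++ (filter P? xs))

  count-none : ∀ {xs} → All (¬_ ∘ P) xs → count P? xs ≡ 0
  count-none none = cong length (filter-none P? none)

  count-singleton-yes : ∀ {x} → P x → count P? [ x ] ≡ 1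
  count-singleton-yes px = cong length (filter-accept P? px)

  count-singleton-no : ∀ {x} → ¬ P x → count P? [ x ] ≡ 0
  count-singleton-no ¬px = cong length (filter-reject P? ¬px)

  count-map : ∀ {b} {B : Set b} (f : B → A) xs → count P? (map f xs) ≡ count (P? ∘ f) xs
  count-map f []       = refl
  count-map f (x ∷ xs) with does (P? (f x))
  ... | true  = cong suc (count-map f xs)
  ... | false = count-map f xs

  count-concatMap : ∀ {b} {B : Set b} (f : B → List A) xs →
    count P? (concatMap f xs) ≡ sum (map (count P? ∘ f) xs)
  count-concatMap f []       = refl
  count-concatMap f (x ∷ xs) =
    trans (count-++ (f x) (concatMap f xs)) (cong (count P? (f x) +_) (count-concatMap f xs))

  sum-indicator : (f : A → ℕ) (k : ℕ) → (∀ x → P x → f x ≡ k) → (∀ x → ¬ P x → f x ≡ 0) →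
    ∀ xs → sum (map f xs) ≡ count P? xs * k
  sum-indicator f k on off []       = refl
  sum-indicator f k on off (x ∷ xs) with P? x
  ... | yes px = cong₂ _+_ (on x px) (sum-indicator f k on off xs)
  ... | no ¬px = cong₂ _+_ (off x ¬px) (sum-indicator f k on off xs)

count-≐ : ∀ {a p q} {A : Set a} {P : Pred A p} {Q : Pred A q} (P? : Decidable P) (Q? : Decidable Q) →
  (∀ {x} → P x → Q x) → (∀ {x} → Q x → P x) → ∀ xs → count P? xs ≡ count Q? xs
count-≐ P? Q? P⇒Q Q⇒P xs = cong length (filter-≐ P? Q? (P⇒Q , Q⇒P) xs)

sum-const : ∀ {a} {A : Set a} (c : ℕ) (xs : List A) → sum (map (λ _ → c) xs) ≡ length xs * c
sum-const c []       = refl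
sum-const c (x ∷ xs) = cong (c +_) (sum-const c xs)

sum-map-+ : ∀ {a} {A : Set a} (f g : A → ℕ) xs →
  sum (map (λ x → f x + g x) xs) ≡ sum (map f xs) + sum (map g xs)
sum-map-+ f g []       = refl
sum-map-+ f g (x ∷ xs) = trans (cong (f x + g x +_) (sum-map-+ f g xs))
                               (interchange (f x) (g x) (sum (map f xs)) (sum (map g xs)))

double-count : ∀ {a b r} {A : Set a} {B : Set b} {R : A → B → Set r} (R? : ∀ g u → Dec (R g u))
  (gs : List A) (us : List B) →
  sum (map (λ u → count (λ g → R? g u) gs) us) ≡ sum (map (λ g → count (R? g) us) gs)
double-count R? []       us = trans (sum-const 0 us) (*-zeroʳ (length us))
double-count R? (g ∷ gs) us = begin
  sum (map (λ u → count (λ h → R? h u) (g ∷ gs)) us)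
    ≡⟨ cong sum (map-cong (λ u → count-++ (λ h → R? h u) [ g ] gs) us) ⟩
  sum (map (λ u → count (λ h → R? h u) [ g ] + count (λ h → R? h u) gs) us)
    ≡⟨ sum-map-+ (λ u → count (λ h → R? h u) [ g ]) (λ u → count (λ h → R? h u) gs) us ⟩
  sum (map (λ u → count (λ h → R? h u) [ g ]) us) + sum (map (λ u → count (λ h → R? h u) gs) us)
    ≡⟨ cong₂ _+_ row (double-count R? gs us) ⟩
  count (R? g) us + sum (map (λ h → count (R? h) us) gs) ∎
  where
    open ≡-Reasoning
    row : sum (map (λ u → count (λ h → R? h u) [ g ]) us) ≡ count (R? g) us
    row = trans (sum-indicator (R? g) _ 1 (λ u → count-singleton-yes (λ h → R? h u))
                                          (λ u → count-singleton-no (λ h → R? h u)) us)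
                (*-identityʳ _)

letters : ∀ q → List (Fin q)
letters zero    = []
letters (suc q) = fzero ∷ map fsuc (letters q)

vertices : ∀ m {q} → List (Vertex m q)
vertices zero        = [ [] ]
vertices (suc m) {q} = concatMap (λ a → map (a ∷_) (vertices m)) (letters q)

length-letters : ∀ q → length (letters q) ≡ q
length-letters zero    = refl
length-letters (suc q) = cong suc (trans (length-map fsuc (letters q)) (length-letters q))

letters-unique : ∀ {q} (b : Fin q) → count (b F.≟_) (letters q) ≡ 1
letters-unique {suc q} fzero =
  cong suc (trans (count-map (fzero F.≟_) fsuc (letters q))
                  (count-none (λ c → fzero F.≟ fsuc c) (All.universal (λ _ ()) (letters q))))
letters-unique {suc q} (fsuc b) = begin
  count (fsuc b F.≟_) (map fsuc (letters q))  ≡⟨ count-map (fsuc b F.≟_) fsuc (letters q) ⟩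
  count (λ c → fsuc b F.≟ fsuc c) (letters q) ≡⟨ count-≐ _ (b F.≟_) Finₚ.suc-injective (cong fsuc) (letters q) ⟩
  count (b F.≟_) (letters q)                  ≡⟨ letters-unique b ⟩
  1                                           ∎
  where open ≡-Reasoning

count-vertices-suc : ∀ {m q p} {P : Pred (Vertex (suc m) q) p} (P? : Decidable P) →
  count P? (vertices (suc m)) ≡ sum (map (λ a → count (λ u → P? (a ∷ u)) (vertices m)) (letters q))
count-vertices-suc {m} {q} P? =
  trans (count-concatMap P? (λ a → map (a ∷_) (vertices m)) (letters q))
        (cong sum (map-cong (λ a → count-map P? (a ∷_) (vertices m)) (letters q)))

vertices-unique : ∀ {m q} (w : Vertex m q) → count (w ≟V_) (vertices m) ≡ 1
vertices-unique {zero}      []       = refl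
vertices-unique {suc m} {q} (b ∷ ws) = begin
  count ((b ∷ ws) ≟V_) (vertices (suc m))
    ≡⟨ count-vertices-suc ((b ∷ ws) ≟V_) ⟩
  sum (map (λ a → count (λ u → (b ∷ ws) ≟V (a ∷ u)) (vertices m)) (letters q))
    ≡⟨ sum-indicator (b F.≟_) _ 1 same-letter other-letter (letters q) ⟩
  count (b F.≟_) (letters q) * 1
    ≡⟨ trans (*-identityʳ _) (letters-unique b) ⟩
  1 ∎
  where
    open ≡-Reasoning
    same-letter : ∀ a → b ≡ a → count (λ u → (b ∷ ws) ≟V (a ∷ u)) (vertices m) ≡ 1
    same-letter a refl = trans (count-≐ _ (ws ≟V_) (proj₂ ∘ ∷-injective) (cong (b ∷_)) (vertices m))
                               (vertices-unique ws)
    other-letter : ∀ a → b ≢ a → count (λ u → (b ∷ ws) ≟V (a ∷ u)) (vertices m) ≡ 0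
    other-letter a b≢a = count-none (λ u → (b ∷ ws) ≟V (a ∷ u))
                           (All.universal (λ _ → b≢a ∘ proj₁ ∘ ∷-injective) (vertices m))

count-by-key : ∀ {a m q} {A : Set a} (key : A → Vertex m q) (gs : List A) →
  length gs ≡ sum (map (λ u → count (λ g → key g ≟V u) gs) (vertices m))
count-by-key {m = m} key gs = sym (begin
  sum (map (λ u → count (λ g → key g ≟V u) gs) (vertices m))
    ≡⟨ double-count (λ g u → key g ≟V u) gs (vertices m) ⟩
  sum (map (λ g → count (key g ≟V_) (vertices m)) gs)
    ≡⟨ cong sum (map-cong (vertices-unique ∘ key) gs) ⟩
  sum (map (λ _ → 1) gs)
    ≡⟨ trans (sum-const 1 gs) (*-identityʳ (length gs)) ⟩
  length gs ∎)
  where open ≡-Reasoning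

-- A vertex of H(m+1,q) is at distance j from 𝟎 iff either its first letter
-- is 0 and its tail is at distance j, or its first letter is one of the q-1
-- others and its tail is at distance j-1.
sphere-step : ∀ {q} (q≥2 : 2 ≤ q) m j →
  count (λ u → dist (𝟎 q≥2) u ≟ j) (vertices (suc m))
    ≡ count (λ u → dist (𝟎 q≥2) u ≟ j) (vertices m)
      + (q ∸ 1) * count (λ u → suc (dist (𝟎 q≥2) u) ≟ j) (vertices m)
sphere-step {suc (suc r)} q≥2@(s≤s (s≤s z≤n)) m j = begin
  count (λ u → dist (𝟎 q≥2) u ≟ j) (vertices (suc m))
    ≡⟨ count-vertices-suc {m} (λ u → dist (𝟎 q≥2) u ≟ j) ⟩
  centred + sum (map offCentre (map fsuc (letters (suc r))))
    ≡⟨ cong (centred +_) (cong sum (sym (map-∘ (letters (suc r))))) ⟩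
  centred + sum (map (λ _ → shifted) (letters (suc r)))
    ≡⟨ cong (centred +_) (sum-const shifted (letters (suc r))) ⟩
  centred + length (letters (suc r)) * shifted
    ≡⟨ cong (λ n → centred + n * shifted) (length-letters (suc r)) ⟩
  centred + suc r * shifted ∎
  where
    open ≡-Reasoning
    centred : ℕ
    centred = count (λ u → dist (𝟎 q≥2) u ≟ j) (vertices m)
    offCentre : Fin (suc (suc r)) → ℕ
    offCentre a = count (λ u → dist (𝟎 q≥2) (a ∷ u) ≟ j) (vertices m)
    shifted : ℕ
    shifted = count (λ u → suc (dist (𝟎 q≥2) u) ≟ j) (vertices m)

sphere-size : ∀ {q} (q≥2 : 2 ≤ q) m j →
  count (λ u → dist (𝟎 q≥2) u ≟ j) (vertices m) ≡ (m C j) * (q ∸ 1) ^ j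
sphere-size q≥2 zero    zero    = refl
sphere-size q≥2 zero    (suc j) = refl
sphere-size {q} q≥2 (suc m) zero =
  trans (sphere-step q≥2 m 0)
        (cong₂ _+_ (sphere-size q≥2 m 0)
                   (trans (cong ((q ∸ 1) *_) (count-none _ (All.universal (λ _ ()) (vertices m))))
                          (*-zeroʳ (q ∸ 1))))
sphere-size {q} q≥2 (suc m) (suc j) = begin
  count (λ u → dist (𝟎 q≥2) u ≟ suc j) (vertices (suc m))
    ≡⟨ sphere-step q≥2 m (suc j) ⟩
  S (suc j) + s * count (λ u → suc (dist (𝟎 q≥2) u) ≟ suc j) (vertices m)
    ≡⟨ cong (λ n → S (suc j) + s * n) (count-≐ _ (λ u → dist (𝟎 q≥2) u ≟ j) suc-injective (cong suc) (vertices m)) ⟩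
  S (suc j) + s * S j
    ≡⟨ cong₂ (λ a b → a + s * b) (sphere-size q≥2 m (suc j)) (sphere-size q≥2 m j) ⟩
  (m C suc j) * s ^ suc j + s * ((m C j) * s ^ j)
    ≡⟨ cong ((m C suc j) * s ^ suc j +_) (*-leftSwap s (m C j) (s ^ j)) ⟩
  (m C suc j) * s ^ suc j + (m C j) * s ^ suc j
    ≡⟨ *-distribʳ-+ (s ^ suc j) (m C suc j) (m C j) ⟨
  ((m C suc j) + (m C j)) * s ^ suc j
    ≡⟨ cong (_* s ^ suc j) (trans (+-comm (m C suc j) (m C j)) (nCk+nC[k+1]≡[n+1]C[k+1] m j)) ⟩
  (suc m C suc j) * s ^ suc j ∎
  where
    open ≡-Reasoning
    s : ℕ
    s = q ∸ 1
    S : ℕ → ℕ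
    S k = count (λ u → dist (𝟎 q≥2) u ≟ k) (vertices m)

any-─ : ∀ {b p r} {B : Set b} {P : Pred B p} {Q : Pred B r} {ys : List B} (p : Any P ys) →
  Any Q ys → (∃ λ z → P z × Q z) ⊎ Any Q (ys ─ p)
any-─ (here pz) (here qz) = inj₁ (_ , pz , qz)
any-─ (here _)  (there q) = inj₂ q
any-─ (there _) (here qz) = inj₂ (here qz)
any-─ (there p) (there q) with any-─ p q
... | inj₁ shared = inj₁ shared
... | inj₂ q′     = inj₂ (there q′)

injection-length : ∀ {a b d r} {A : Set a} {B : Set b} {D : A → A → Set d} {R : A → B → Set r}
  {xs : List A} {ys : List B} → AllPairs D xs →
  (∀ {x y z} → R x z → R y z → ¬ D x y) → All (λ x → Any (R x) ys) xs → length xs ≤ length ys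
injection-length [] _ [] = z≤n
injection-length {D = D} {R} {xs = x ∷ rest} {ys} (x#rest ∷ distinct) functional (x↦ ∷ rest↦) = begin
  suc (length rest)       ≤⟨ s≤s (injection-length distinct functional (survivors x#rest rest↦)) ⟩
  suc (length (ys ─ x↦)) ≡⟨ length-removeAt′ ys (index x↦) ⟨
  length ys               ∎
  where
    open ≤-Reasoning
    survivors : ∀ {zs} → All (D x) zs → All (λ y → Any (R y) ys) zs → All (λ y → Any (R y) (ys ─ x↦)) zs
    survivors []           []           = []
    survivors (x#y ∷ x#zs) (y↦ ∷ zs↦) with any-─ x↦ y↦
    ... | inj₁ (_ , xz , yz) = ⊥-elim (functional xz yz x#y)
    ... | inj₂ y↦′           = y↦′ ∷ survivors x#zs zs↦

-- Orbit–stabiliser for finite groups of automorphisms given as duplicate-free lists.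

stabiliser : ∀ {m q} → List (Aut m q) → Vertex m q → List (Aut m q)
stabiliser Y b = filter (λ g → fun g b ≟V b) Y

fibre : ∀ {m q} → List (Aut m q) → Vertex m q → Vertex m q → ℕ
fibre Y v u = count (λ g → fun g v ≟V u) Y

module _ {m q} {Y : List (Aut m q)} {b : Vertex m q} where

  stabiliser⁻ : ∀ {g} → g ∈ stabiliser Y b → g ∈ Y × fun g b ≡ b
  stabiliser⁻ = ∈-filter⁻ (λ g → fun g b ≟V b)

  stabiliser⁺ : ∀ {g} → g ∈ Y → fun g b ≡ b → g ∈ stabiliser Y b
  stabiliser⁺ = ∈-filter⁺ (λ g → fun g b ≟V b)

  stabiliser-preserves-dist : ∀ {g} → g ∈ stabiliser Y b → ∀ v → dist b (fun g v) ≡ dist b v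
  stabiliser-preserves-dist {g} g∈ v =
    trans (cong (λ c → dist c (fun g v)) (sym (proj₂ (stabiliser⁻ g∈)))) (aut-isometry g b v)

module Subgroup {m q} {Y : List (Aut m q)} (S : IsSubgroup Y) where
  open IsSubgroup S

  identity∈ : ∃ λ e → e ∈ Y × (∀ v → fun e v ≡ v)
  identity∈ = find has-id

  compose∈ : ∀ {g h} → g ∈ Y → h ∈ Y → ∃ λ k → k ∈ Y × (∀ v → fun k v ≡ fun g (fun h v))
  compose∈ g∈ h∈ = find (All.lookup (All.lookup comp g∈) h∈)

  inverse∈ : ∀ {g} → g ∈ Y → ∃ λ k → k ∈ Y × (∀ v → fun k v ≡ inv g v)
  inverse∈ g∈ = find (All.lookup inverse g∈)

stabiliser-isSubgroup : ∀ {m q} {Y : List (Aut m q)} → IsSubgroup Y → ∀ b → IsSubgroup (stabiliser Y b)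
stabiliser-isSubgroup {Y = Y} S b = record
  { distinct = AllPairs.filter⁺ (λ g → fun g b ≟V b) (IsSubgroup.distinct S)
  ; has-id   = let e , e∈ , e≗id = identity∈ in lose (stabiliser⁺ e∈ (e≗id b)) e≗id
  ; comp     = All.tabulate λ g∈ → All.tabulate λ h∈ → product g∈ h∈
  ; inverse  = All.tabulate inverse-fixes
  }
  where
    open Subgroup S
    product : ∀ {g h} → g ∈ stabiliser Y b → h ∈ stabiliser Y b →
      Any (λ k → ∀ v → fun k v ≡ fun g (fun h v)) (stabiliser Y b)
    product {g} g∈ h∈ =
      let g∈Y , gb = stabiliser⁻ g∈
          h∈Y , hb = stabiliser⁻ h∈
          k , k∈ , k≗gh = compose∈ g∈Y h∈Y
      in lose (stabiliser⁺ k∈ (trans (k≗gh b) (trans (cong (fun g) hb) gb))) k≗gh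
    inverse-fixes : ∀ {g} → g ∈ stabiliser Y b → Any (λ k → ∀ v → fun k v ≡ inv g v) (stabiliser Y b)
    inverse-fixes {g} g∈ =
      let g∈Y , gb = stabiliser⁻ g∈
          k , k∈ , k≗g⁻¹ = inverse∈ g∈Y
      in lose (stabiliser⁺ k∈ (trans (k≗g⁻¹ b) (trans (cong (inv g) (sym gb)) (inv-l g b)))) k≗g⁻¹

module _ {m q} {Y : List (Aut m q)} (S : IsSubgroup Y) where
  open Subgroup S

  -- Left multiplication by h ∈ Y maps {g : g v = u} injectively into {g : g v = h u}.
  fibre-translate : ∀ {h} → h ∈ Y → ∀ v u → fibre Y v u ≤ fibre Y v (fun h u)
  fibre-translate {h} h∈ v u =
    injection-length (AllPairs.filter⁺ (λ g → fun g v ≟V u) (IsSubgroup.distinct S))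
      (λ k≗hx k≗hy x≉y → x≉y (λ w → aut-injective h (trans (sym (k≗hx w)) (k≗hy w))))
      (All.tabulate image)
    where
      image : ∀ {x} → x ∈ filter (λ g → fun g v ≟V u) Y →
        Any (λ k → ∀ w → fun k w ≡ fun h (fun x w)) (filter (λ g → fun g v ≟V fun h u) Y)
      image x∈ =
        let x∈Y , xv = ∈-filter⁻ (λ g → fun g v ≟V u) x∈
            k , k∈ , k≗hx = compose∈ h∈ x∈Y
        in lose (∈-filter⁺ (λ g → fun g v ≟V fun h u) k∈ (trans (k≗hx v) (cong (fun h) xv))) k≗hx

  fibre-invariant : ∀ {h v u} → h ∈ Y → fibre Y v u ≡ fibre Y v (fun h u)
  fibre-invariant {h} {v} {u} h∈ = ≤-antisym (fibre-translate h∈ v u) back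
    where
      back : fibre Y v (fun h u) ≤ fibre Y v u
      back = let h′ , h′∈ , h′≗h⁻¹ = inverse∈ h∈ in
        subst (λ w → fibre Y v (fun h u) ≤ fibre Y v w) (trans (h′≗h⁻¹ (fun h u)) (inv-l h u))
              (fibre-translate h′∈ v (fun h u))

  orbit-stabiliser : ∀ v {o} {O : Pred (Vertex m q) o} (O? : Decidable O) →
    (∀ {g} → g ∈ Y → O (fun g v)) → (∀ {u} → O u → ∃ λ h → h ∈ Y × fun h v ≡ u) →
    length Y ≡ count O? (vertices m) * length (stabiliser Y v)
  orbit-stabiliser v {O = O} O? into onto = begin
    length Y                                        ≡⟨ count-by-key (λ g → fun g v) Y ⟩
    sum (map (fibre Y v) (vertices m))              ≡⟨ sum-indicator O? (fibre Y v) (fibre Y v v) inside outside (vertices m) ⟩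
    count O? (vertices m) * length (stabiliser Y v) ∎
    where
      open ≡-Reasoning
      inside : ∀ u → O u → fibre Y v u ≡ fibre Y v v
      inside u Ou = let h , h∈ , hv≡u = onto Ou in
        sym (trans (fibre-invariant h∈) (cong (fibre Y v) hv≡u))
      outside : ∀ u → ¬ O u → fibre Y v u ≡ 0
      outside u ¬Ou = count-none (λ g → fun g v ≟V u) (All.tabulate λ g∈ gv≡u → ¬Ou (subst O gv≡u (into g∈)))

  stabiliser-order-divides : ∀ b → length (stabiliser Y b) ∣ length Y
  stabiliser-order-divides b =
    divides (count orbit? (vertices m)) (orbit-stabiliser b orbit? (λ g∈ → lose g∈ refl) find)
    where
      orbit? : Decidable (λ u → Any (λ g → fun g b ≡ u) Y)
      orbit? u = any? (λ g → fun g b ≟V u) Y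

module _ {m q} {Cd : Code m q} (δ≥5 : MinDistAtLeast Cd 5) where

  codeword-within-2-unique : ∀ {c c′ w} → Cd c → Cd c′ → dist c w ≤ 2 → dist w c′ ≤ 2 → c ≡ c′
  codeword-within-2-unique {c} {c′} {w} Cc Cc′ cw wc′ with c ≟V c′
  ... | yes c≡c′ = c≡c′
  ... | no  c≢c′ = ⊥-elim (1+n≰n (begin
    5                     ≤⟨ δ≥5 c c′ Cc Cc′ c≢c′ ⟩
    dist c c′             ≤⟨ dist-triangle c w c′ ⟩
    dist c w + dist w c′  ≤⟨ +-mono-≤ cw wc′ ⟩
    4                     ∎))
    where open ≤-Reasoning

  sphere₂⊆C₂ : ∀ {b w} → Cd b → dist b w ≡ 2 → DistSet Cd 2 w
  sphere₂⊆C₂ {b} {w} Cb bw = (b , Cb , wb) , far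
    where
      wb : dist w b ≡ 2
      wb = trans (dist-sym w b) bw
      far : ∀ c → Cd c → 2 ≤ dist w c
      far c Cc with 2 ≤? dist w c
      ... | yes ok    = ok
      ... | no  close = ⊥-elim (close (subst (λ c′ → 2 ≤ dist w c′) b≡c (≤-reflexive (sym wb))))
        where
          b≡c : b ≡ c
          b≡c = codeword-within-2-unique Cb Cc (≤-reflexive bw) (<⇒≤ (≰⇒> close))

  stabiliser-transitive-on-sphere₂ : ∀ {X : List (Aut m q)} {b} → StabilisesCode X Cd →
    TransitiveOn X (DistSet Cd 2) → Cd b →
    ∀ {v u} → dist b v ≡ 2 → dist b u ≡ 2 → ∃ λ h → h ∈ stabiliser X b × fun h v ≡ u
  stabiliser-transitive-on-sphere₂ {X} {b} stabilises transitive Cb {v} {u} bv bu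
    with find (transitive v u (sphere₂⊆C₂ Cb bv) (sphere₂⊆C₂ Cb bu))
  ... | h , h∈ , hv≡u = h , stabiliser⁺ h∈ (sym b≡hb) , hv≡u
    where
      C-hb : Cd (fun h b)
      C-hb = Equivalence.to (All.lookup stabilises h∈ b) Cb
      u-hb : dist u (fun h b) ≡ 2
      u-hb = begin
        dist u (fun h b)         ≡⟨ dist-sym u (fun h b) ⟩
        dist (fun h b) u         ≡⟨ cong (dist (fun h b)) hv≡u ⟨
        dist (fun h b) (fun h v) ≡⟨ aut-isometry h b v ⟩
        dist b v                 ≡⟨ bv ⟩
        2                        ∎
        where open ≡-Reasoning
      b≡hb : b ≡ fun h b
      b≡hb = codeword-within-2-unique Cb C-hb (≤-reflexive bu) (≤-reflexive u-hb)

sphere₂-point : ∀ {m q} (q≥2 : 2 ≤ q) → 2 ≤ m → ∃ λ (v : Vertex m q) → dist (𝟎 q≥2) v ≡ 2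
sphere₂-point {suc (suc m)} q≥2@(s≤s (s≤s z≤n)) (s≤s (s≤s _)) =
  fsuc fzero ∷ fsuc fzero ∷ 𝟎 q≥2 , cong (λ n → suc (suc n)) (dist-refl (𝟎 {m} q≥2))

half-product≡C2 : ∀ m → 2 ≤ m → m * (m ∸ 1) / 2 ≡ m C 2
half-product≡C2 m@(suc (suc n)) 2≤m@(s≤s (s≤s _)) = begin
  m * suc n / 2          ≡⟨ cong (_/ 2) (trans (*-comm m (suc n)) (cong (suc n *_) (sym (*-identityʳ m)))) ⟩
  suc n * (m * 1) / 2    ≡⟨ nCk≡nPk/k! 2≤m ⟨
  m C 2                  ∎
  where open ≡-Reasoning

C2-positive : ∀ m → 2 ≤ m → 0 < m C 2
C2-positive m@(suc (suc n)) 2≤m@(s≤s (s≤s _)) =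
  subst (0 <_) (half-product≡C2 m 2≤m) (m≥n⇒m/n>0 (*-mono-≤ 2≤m (s≤s (z≤n {n}))))

square-factor-trivial : ∀ {c s k} → 0 < c → c * s ^ 2 * k ≡ c → s ≡ 1
square-factor-trivial {c} {s} {k} c>0 e =
  m*n≡1⇒m≡1 s (s * 1) (m*n≡1⇒m≡1 (s ^ 2) k (*-cancelˡ-≡ (s ^ 2 * k) 1 c {{>-nonZero c>0}} c·s²k≡c·1))
  where
    c·s²k≡c·1 : c * (s ^ 2 * k) ≡ c * 1
    c·s²k≡c·1 = trans (sym (*-assoc c (s ^ 2) k)) (trans e (sym (*-identityʳ c)))

lemma2p10 : (m q : ℕ) (q2 : 2 ≤ q) (Cd : Code m q) (X : List (Aut m q)) →
    IsSubgroup X →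
    NeighbourTransitive X Cd 2 →
    Cd (𝟎 q2) →
    (∃ λ c → Cd c × c ≢ 𝟎 q2) →
    MinDistAtLeast Cd 5 →
    ((m C 2) * (q ∸ 1) ^ 2 ∣ stabOrder q2 X)
      × ((m C 2) * (q ∸ 1) ^ 2 ∣ order X)
      × (stabOrder q2 X ≡ m * (m ∸ 1) / 2 → q ≡ 2)
lemma2p10 m q q≥2 Cd X S (stabilises , transitive) C𝟎 (c , Cc , c≢𝟎) δ≥5 =
  sphere∣X₀ , ∣-trans sphere∣X₀ (stabiliser-order-divides S (𝟎 q≥2)) , binary
  where
    X₀ = stabiliser X (𝟎 q≥2)
    m≥2 : 2 ≤ m
    m≥2 = ≤-trans (s≤s (s≤s z≤n)) (≤-trans (δ≥5 _ _ C𝟎 Cc (c≢𝟎 ∘ sym)) (dist≤length (𝟎 q≥2) c))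
    v   = proj₁ (sphere₂-point q≥2 m≥2)
    𝟎v  = proj₂ (sphere₂-point q≥2 m≥2)
    |X₀| : length X₀ ≡ (m C 2) * (q ∸ 1) ^ 2 * length (stabiliser X₀ v)
    |X₀| = trans
      (orbit-stabiliser (stabiliser-isSubgroup S (𝟎 q≥2)) v (λ u → dist (𝟎 q≥2) u ≟ 2)
        (λ g∈ → trans (stabiliser-preserves-dist {Y = X} {b = 𝟎 q≥2} g∈ v) 𝟎v)
        (stabiliser-transitive-on-sphere₂ δ≥5 stabilises (transitive 2 ≤-refl) C𝟎 𝟎v))
      (cong (_* length (stabiliser X₀ v)) (sphere-size q≥2 m 2))
    sphere∣X₀ : (m C 2) * (q ∸ 1) ^ 2 ∣ length X₀
    sphere∣X₀ = divides (length (stabiliser X₀ v)) (trans |X₀| (*-comm ((m C 2) * (q ∸ 1) ^ 2) (length (stabiliser X₀ v))))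
    binary : length X₀ ≡ m * (m ∸ 1) / 2 → q ≡ 2
    binary e = trans (sym (m∸n+n≡m (≤-trans (s≤s z≤n) q≥2))) (cong (_+ 1) q-1≡1)
      where
        q-1≡1 : q ∸ 1 ≡ 1
        q-1≡1 = square-factor-trivial (C2-positive m m≥2) (trans (sym |X₀|) (trans e (half-product≡C2 m m≥2)))
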